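{- Let $D=\frac d{dz}$, $M_0=(1-z)D-1$, $M_1=(1-2z)D^2-(3-z)D$, and $M_k=M_{k-1}D-M_{k-2}(D^2z-zD)$ for $k\ge2$. Then $M_k$ is a linear differential operator of order $k+1$ of the form $$M_k=m_{k,k}(z)D^{k+1}+m_{k,k-1}(z)D^k+\dots+m_{k,0}(z)D+m_{k,-1}(z)$$ with polynomials $m_{k,i}$, where $m_{0,-1}=-1$, $m_{0,0}=1-z$, $m_{1,-1}=0$, $m_{1,0}=z-3$, $m_{1,1}=1-2z$, and for $k\ge2$: $m_{k,-1}=0$; $m_{k,0}=-2z+3$ if $k$ is even and $m_{k,0}=z-3$ if $k$ is odd; $m_{k,i}=m_{k-1,i-1}+(i+1)m_{k-2,i}+(z-i-2)m_{k-2,i-1}-z\,m_{k-2,i-2}$ for $1\le i\le k-1$; $m_{k,k}=m_{k-1,k-1}-z\,m_{k-2,k-2}$; and $m_{k,i}=0$ for $i>k$. Moreover $m_{k,k}(z)=\ell_{k,k}(z)$ for all $k$, where $\ell_{0,0}=1-z$, $\ell_{1,1}=1-2z$, $\ell_{k,k}=\ell_{k-1,k-1}-z\ell_{k-2,k-2}$.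
   Context: Operators compose as products, $z$ acts by multiplication, $D^2z$ is $F\mapsto(zF)''$, $zD$ is $F\mapsto zF'$. In the recurrence, $m_{j,i}$ with $i>j$ or $i<-1$ is taken to be $0$. -}

module Defs where

open import Data.Bool using (Bool; true; false; if_then_else_; _∧_)
open import Data.Nat as ℕ using (ℕ; zero; suc)
open import Data.Integer as ℤ using (ℤ; +_; -[1+_]; 0ℤ; 1ℤ; -1ℤ; _+_; _*_; _-_; -_; _≤ᵇ_)
open import Data.List using (List; []; _∷_; map)

-- Polynomials in z over ℤ: coefficient lists, constant term first
-- (trailing zeros allowed; polynomials are compared via `coeff`).

Poly : Set
Poly = List ℤ

coeff : Poly → ℕ → ℤ
coeff []       _       = 0ℤ
coeff (a ∷ p)  zero    = a
coeff (a ∷ p)  (suc n) = coeff p n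

infixl 6 _⊕_
_⊕_ : Poly → Poly → Poly
[]      ⊕ q       = q
(a ∷ p) ⊕ []      = a ∷ p
(a ∷ p) ⊕ (b ∷ q) = (a + b) ∷ (p ⊕ q)

scale : ℤ → Poly → Poly
scale c p = map (c *_) p

negP : Poly → Poly
negP p = scale -1ℤ p

infixl 7 _⊗_
_⊗_ : Poly → Poly → Poly
[]      ⊗ q = []
(a ∷ p) ⊗ q = scale a q ⊕ (0ℤ ∷ (p ⊗ q))

Z : Poly
Z = 0ℤ ∷ 1ℤ ∷ []

-- Functions the operators act on: formal power series in z over ℤ,
-- given by their coefficient sequences (this contains ℤ[z]).

Series : Set
Series = ℕ → ℤ

D : Series → Series
D F n = + (suc n) * F (suc n)

Dpow : ℕ → Series → Series
Dpow zero    F = F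
Dpow (suc j) F = D (Dpow j F)

zmul : Series → Series
zmul F zero    = 0ℤ
zmul F (suc n) = F n

pmul : Poly → Series → Series
pmul []      F n = 0ℤ
pmul (a ∷ p) F n = a * F n + zmul (pmul p F) n

_⊞_ : Series → Series → Series
(F ⊞ G) n = F n + G n

_⊟_ : Series → Series → Series
(F ⊟ G) n = F n - G n

Op : Set
Op = Series → Series

M₀ : Op
M₀ F = pmul (1ℤ ∷ -1ℤ ∷ []) (D F) ⊟ F

M₁ : Op
M₁ F = pmul (1ℤ ∷ - (+ 2) ∷ []) (D (D F)) ⊟ pmul (+ 3 ∷ -1ℤ ∷ []) (D F)

M : ℕ → Op
M zero          = M₀
M (suc zero)    = M₁
M (suc (suc k)) F = M (suc k) (D F) ⊟ M k (D (D (zmul F)) ⊟ zmul (D F))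

infix 4 _=ᵇ_
_=ᵇ_ : ℤ → ℤ → Bool
i =ᵇ j = (i ≤ᵇ j) ∧ (j ≤ᵇ i)

evenᵇ : ℕ → Bool
evenᵇ zero          = true
evenᵇ (suc zero)    = false
evenᵇ (suc (suc k)) = evenᵇ k

m : ℕ → ℤ → Poly
m zero i =
  if i =ᵇ -1ℤ then -1ℤ ∷ []
  else if i =ᵇ 0ℤ then 1ℤ ∷ -1ℤ ∷ []
  else []
m (suc zero) i =
  if i =ᵇ -1ℤ then []
  else if i =ᵇ 0ℤ then - (+ 3) ∷ 1ℤ ∷ []
  else if i =ᵇ 1ℤ then 1ℤ ∷ - (+ 2) ∷ []
  else []
m (suc (suc k)) i =
  if i ≤ᵇ -1ℤ then []
  else if i =ᵇ 0ℤ then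
    (if evenᵇ (suc (suc k)) then + 3 ∷ - (+ 2) ∷ []
     else - (+ 3) ∷ 1ℤ ∷ [])
  else if i ≤ᵇ (+ suc k) then                      -- 1 ≤ i ≤ k-1 (here k-1 = suc k)
    ((m (suc k) (i - 1ℤ)
      ⊕ scale (i + 1ℤ) (m k i))
      ⊕ (((- (i + (+ 2))) ∷ 1ℤ ∷ []) ⊗ m k (i - 1ℤ)))
      ⊕ negP (Z ⊗ m k (i - (+ 2)))
  else if i =ᵇ (+ suc (suc k)) then
    m (suc k) (+ suc k) ⊕ negP (Z ⊗ m k (+ k))
  else []

ℓ : ℕ → Poly
ℓ zero          = 1ℤ ∷ -1ℤ ∷ []
ℓ (suc zero)    = 1ℤ ∷ - (+ 2) ∷ []
ℓ (suc (suc k)) = ℓ (suc k) ⊕ negP (Z ⊗ ℓ k)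

sumS : ℕ → (ℕ → Series) → Series
sumS zero    f n = 0ℤ
sumS (suc j) f n = sumS j f n + f j n

-- m_{k,k} D^{k+1} + ... + m_{k,0} D + m_{k,-1}  (j = i+1 ranges over 0..k+1)
mOp : ℕ → Op
mOp k F = sumS (suc (suc k)) (λ j → pmul (m k ((+ j) - 1ℤ)) (Dpow j F))

-- The commutation rule D z = z D + 1 gives D^j (D²z − zD) = z D^(j+2) + (j+2−z) D^(j+1) − j D^j.
-- Hence a differential operator Σ_j c_j D^j with polynomial coefficients stays one when composed
-- on the right with D (coefficients shift by one) or with D²z − zD (the new j-th coefficient is
-- z c_(j−2) + (j+1−z) c_(j−1) − j c_j). Feeding both into M_k = M_(k−1) D − M_(k−2) (D²z − zD)
-- reproduces the recurrence for m_(k,i); at i = 0 and i = k it collapses because m_(k−2,i)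
-- vanishes outside −1 ≤ i ≤ k−2. On the diagonal this is the recurrence of ℓ, whose constant
-- term stays 1, so the leading coefficient is never zero.
module Submission where

open import Defs
open import Data.Bool using (true; false)
open import Data.Bool.Properties using (T-≡)
open import Data.Integer using (ℤ; +_; 0ℤ; 1ℤ; -1ℤ; _+_; _*_; _-_; -_)
open import Data.Integer.Properties using (*-distribˡ-+; *-identityˡ; *-zeroʳ; +-identityˡ; +-identityʳ; -1*i≡-i)
open import Data.Integer.Tactic.RingSolver using (solve-∀)
open import Data.List using ([]; _∷_)
open import Data.Nat as ℕ using (ℕ; zero; suc; _≤_; _<_; s≤s)
import Data.Nat.Properties as ℕ
open import Data.Product using (_×_; ∃; _,_; proj₂)
open import Data.Sum using (inj₁; inj₂)
open import Function.Bundles using (Equivalence)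
open import Relation.Binary.PropositionalEquality

infixr 30 _⊙_
_⊙_ : ℤ → Series → Series
(a ⊙ F) n = a * F n

0ˢ : Series
0ˢ _ = 0ℤ

zmul-cong : ∀ {F G} → F ≗ G → zmul F ≗ zmul G
zmul-cong F≗G zero    = refl
zmul-cong F≗G (suc n) = F≗G n

zmul-0ˢ : zmul 0ˢ ≗ 0ˢ
zmul-0ˢ zero    = refl
zmul-0ˢ (suc n) = refl

zmul-⊞ : ∀ F G → zmul (F ⊞ G) ≗ zmul F ⊞ zmul G
zmul-⊞ F G zero    = refl
zmul-⊞ F G (suc n) = refl

zmul-⊟ : ∀ F G → zmul (F ⊟ G) ≗ zmul F ⊟ zmul G
zmul-⊟ F G zero    = refl
zmul-⊟ F G (suc n) = refl

zmul-⊙ : ∀ a F → zmul (a ⊙ F) ≗ a ⊙ zmul F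
zmul-⊙ a F zero    = sym (*-zeroʳ a)
zmul-⊙ a F (suc n) = refl

D-cong : ∀ {F G} → F ≗ G → D F ≗ D G
D-cong F≗G n = cong (+ suc n *_) (F≗G (suc n))

D-⊞ : ∀ F G → D (F ⊞ G) ≗ D F ⊞ D G
D-⊞ F G n = *-distribˡ-+ (+ suc n) (F (suc n)) (G (suc n))

D-⊟ : ∀ F G → D (F ⊟ G) ≗ D F ⊟ D G
D-⊟ F G n = distrib (+ suc n) (F (suc n)) (G (suc n))
  where
    distrib : ∀ s x y → s * (x - y) ≡ s * x - s * y
    distrib = solve-∀

D-⊙ : ∀ a F → D (a ⊙ F) ≗ a ⊙ D F
D-⊙ a F n = swap (+ suc n) a (F (suc n))
  where
    swap : ∀ s a x → s * (a * x) ≡ a * (s * x)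
    swap = solve-∀

D-zmul : ∀ F → D (zmul F) ≗ zmul (D F) ⊞ F
D-zmul F zero    = identity (F 0)
  where
    identity : ∀ x → 1ℤ * x ≡ 0ℤ + x
    identity = solve-∀
D-zmul F (suc n) = distrib (+ suc n) (F (suc n))
  where
    distrib : ∀ s x → (1ℤ + s) * x ≡ s * x + x
    distrib = solve-∀

Dpow-D : ∀ j F → Dpow j (D F) ≗ Dpow (suc j) F
Dpow-D zero    F n = refl
Dpow-D (suc j) F n = D-cong (Dpow-D j F) n

Dpow-⊟ : ∀ j F G → Dpow j (F ⊟ G) ≗ Dpow j F ⊟ Dpow j G
Dpow-⊟ zero    F G n = refl
Dpow-⊟ (suc j) F G n = trans (D-cong (Dpow-⊟ j F G) n) (D-⊟ (Dpow j F) (Dpow j G) n)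

Dpow-zmul : ∀ j F → Dpow (suc j) (zmul F) ≗ zmul (Dpow (suc j) F) ⊞ (+ suc j) ⊙ Dpow j F
Dpow-zmul zero    F n = trans (D-zmul F n) (cong (λ t → zmul (D F) n + t) (sym (*-identityˡ (F n))))
Dpow-zmul (suc j) F n = begin
  D (Dpow (suc j) (zmul F)) n
    ≡⟨ D-cong (Dpow-zmul j F) n ⟩
  D (zmul X ⊞ (+ suc j) ⊙ Dpow j F) n
    ≡⟨ D-⊞ (zmul X) ((+ suc j) ⊙ Dpow j F) n ⟩
  D (zmul X) n + D ((+ suc j) ⊙ Dpow j F) n
    ≡⟨ cong₂ _+_ (D-zmul X n) (D-⊙ (+ suc j) (Dpow j F) n) ⟩
  (zmul (D X) n + X n) + + suc j * X n
    ≡⟨ collect (zmul (D X) n) (X n) (+ suc j) ⟩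
  zmul (D X) n + + suc (suc j) * X n
    ∎
  where
    open ≡-Reasoning
    X = Dpow (suc j) F
    collect : ∀ z x s → (z + x) + s * x ≡ z + (1ℤ + s) * x
    collect = solve-∀

D²z-zD : Op
D²z-zD F = D (D (zmul F)) ⊟ zmul (D F)

Dpow-zmul-D : ∀ j F → Dpow j (zmul (D F)) ≗ zmul (Dpow (suc j) F) ⊞ (+ j) ⊙ Dpow j F
Dpow-zmul-D zero    F n = sym (+-zero (zmul (D F) n) (F n))
  where
    +-zero : ∀ z x → z + 0ℤ * x ≡ z
    +-zero = solve-∀
Dpow-zmul-D (suc j) F n =
  trans (Dpow-zmul j (D F) n)
        (cong₂ _+_ (zmul-cong (Dpow-D (suc j) F) n) (cong (+ suc j *_) (Dpow-D j F n)))

Dpow-D²z-zD : ∀ j F → Dpow j (D²z-zD F) ≗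
  (zmul (Dpow (2 ℕ.+ j) F) ⊞ ((+ (2 ℕ.+ j)) ⊙ Dpow (1 ℕ.+ j) F ⊟ zmul (Dpow (1 ℕ.+ j) F)))
  ⊟ (+ j) ⊙ Dpow j F
Dpow-D²z-zD j F n = begin
  Dpow j (D²z-zD F) n
    ≡⟨ Dpow-⊟ j (D (D (zmul F))) (zmul (D F)) n ⟩
  Dpow j (D (D (zmul F))) n - Dpow j (zmul (D F)) n
    ≡⟨ cong₂ _-_ (trans (Dpow-D j (D (zmul F)) n) (Dpow-D (suc j) (zmul F) n)) (Dpow-zmul-D j F n) ⟩
  Dpow (2 ℕ.+ j) (zmul F) n - (z₁ + + j * d₀)
    ≡⟨ cong (_- (z₁ + + j * d₀)) (Dpow-zmul (suc j) F n) ⟩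
  (z₂ + + (2 ℕ.+ j) * d₁) - (z₁ + + j * d₀)
    ≡⟨ regroup z₂ (+ (2 ℕ.+ j)) d₁ z₁ (+ j) d₀ ⟩
  (z₂ + (+ (2 ℕ.+ j) * d₁ - z₁)) - + j * d₀
    ∎
  where
    open ≡-Reasoning
    z₂ = zmul (Dpow (2 ℕ.+ j) F) n
    z₁ = zmul (Dpow (1 ℕ.+ j) F) n
    d₁ = Dpow (1 ℕ.+ j) F n
    d₀ = Dpow j F n
    regroup : ∀ z₂ s d₁ z₁ t d₀ → (z₂ + s * d₁) - (z₁ + t * d₀) ≡ (z₂ + (s * d₁ - z₁)) - t * d₀
    regroup = solve-∀

pmul-cong : ∀ p {F G} → F ≗ G → pmul p F ≗ pmul p G
pmul-cong []      F≗G n = refl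
pmul-cong (a ∷ p) F≗G n = cong₂ (λ x y → a * x + y) (F≗G n) (zmul-cong (pmul-cong p F≗G) n)

pmul-⊞ : ∀ p F G → pmul p (F ⊞ G) ≗ pmul p F ⊞ pmul p G
pmul-⊞ []      F G n = refl
pmul-⊞ (a ∷ p) F G n =
  trans (cong (λ t → a * (F n + G n) + t)
              (trans (zmul-cong (pmul-⊞ p F G) n) (zmul-⊞ (pmul p F) (pmul p G) n)))
        (distrib a (F n) (G n) (zmul (pmul p F) n) (zmul (pmul p G) n))
  where
    distrib : ∀ a x y u v → a * (x + y) + (u + v) ≡ (a * x + u) + (a * y + v)
    distrib = solve-∀

pmul-⊟ : ∀ p F G → pmul p (F ⊟ G) ≗ pmul p F ⊟ pmul p G
pmul-⊟ []      F G n = refl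
pmul-⊟ (a ∷ p) F G n =
  trans (cong (λ t → a * (F n - G n) + t)
              (trans (zmul-cong (pmul-⊟ p F G) n) (zmul-⊟ (pmul p F) (pmul p G) n)))
        (distrib a (F n) (G n) (zmul (pmul p F) n) (zmul (pmul p G) n))
  where
    distrib : ∀ a x y u v → a * (x - y) + (u - v) ≡ (a * x + u) - (a * y + v)
    distrib = solve-∀

pmul-⊙ : ∀ p b F → pmul p (b ⊙ F) ≗ b ⊙ pmul p F
pmul-⊙ []      b F n = sym (*-zeroʳ b)
pmul-⊙ (a ∷ p) b F n =
  trans (cong (λ t → a * (b * F n) + t)
              (trans (zmul-cong (pmul-⊙ p b F) n) (zmul-⊙ b (pmul p F) n)))
        (distrib a b (F n) (zmul (pmul p F) n))
  where
    distrib : ∀ a b x u → a * (b * x) + b * u ≡ b * (a * x + u)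
    distrib = solve-∀

pmul-zmul : ∀ p F → pmul p (zmul F) ≗ zmul (pmul p F)
pmul-zmul []      F n       = sym (zmul-0ˢ n)
pmul-zmul (a ∷ p) F zero    = cong (_+ 0ℤ) (*-zeroʳ a)
pmul-zmul (a ∷ p) F (suc n) = cong (λ t → a * F n + t) (pmul-zmul p F n)

pmul-⊕ : ∀ p q F → pmul (p ⊕ q) F ≗ pmul p F ⊞ pmul q F
pmul-⊕ []      q       F n = sym (+-identityˡ (pmul q F n))
pmul-⊕ (a ∷ p) []      F n = sym (+-identityʳ (pmul (a ∷ p) F n))
pmul-⊕ (a ∷ p) (b ∷ q) F n =
  trans (cong (λ t → (a + b) * F n + t)
              (trans (zmul-cong (pmul-⊕ p q F) n) (zmul-⊞ (pmul p F) (pmul q F) n)))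
        (distrib a b (F n) (zmul (pmul p F) n) (zmul (pmul q F) n))
  where
    distrib : ∀ a b x u v → (a + b) * x + (u + v) ≡ (a * x + u) + (b * x + v)
    distrib = solve-∀

pmul-scale : ∀ a p F → pmul (scale a p) F ≗ a ⊙ pmul p F
pmul-scale a []      F n = sym (*-zeroʳ a)
pmul-scale a (b ∷ p) F n =
  trans (cong (λ t → (a * b) * F n + t)
              (trans (zmul-cong (pmul-scale a p F) n) (zmul-⊙ a (pmul p F) n)))
        (distrib a b (F n) (zmul (pmul p F) n))
  where
    distrib : ∀ a b x u → (a * b) * x + a * u ≡ a * (b * x + u)
    distrib = solve-∀

pmul-⊗ : ∀ p q F → pmul (p ⊗ q) F ≗ pmul p (pmul q F)
pmul-⊗ []      q F n = refl
pmul-⊗ (a ∷ p) q F n = begin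
  pmul (scale a q ⊕ (0ℤ ∷ p ⊗ q)) F n
    ≡⟨ pmul-⊕ (scale a q) (0ℤ ∷ p ⊗ q) F n ⟩
  pmul (scale a q) F n + (0ℤ * F n + zmul (pmul (p ⊗ q) F) n)
    ≡⟨ cong₂ (λ x y → x + (0ℤ * F n + y)) (pmul-scale a q F n) (zmul-cong (pmul-⊗ p q F) n) ⟩
  a * pmul q F n + (0ℤ * F n + zmul (pmul p (pmul q F)) n)
    ≡⟨ cong (λ t → a * pmul q F n + t) (+-identityˡ (zmul (pmul p (pmul q F)) n)) ⟩
  a * pmul q F n + zmul (pmul p (pmul q F)) n
    ∎
  where open ≡-Reasoning

pmul-constant : ∀ a F → pmul (a ∷ []) F ≗ a ⊙ F
pmul-constant a F n = trans (cong (λ t → a * F n + t) (zmul-0ˢ n)) (+-identityʳ (a * F n))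

pmul-linear : ∀ a b F → pmul (a ∷ b ∷ []) F ≗ a ⊙ F ⊞ b ⊙ zmul F
pmul-linear a b F n =
  cong (λ t → a * F n + t) (trans (zmul-cong (pmul-constant b F) n) (zmul-⊙ b F n))

pmul-Z : ∀ F → pmul Z F ≗ zmul F
pmul-Z F n = trans (pmul-linear 0ℤ 1ℤ F n) (simplify (F n) (zmul F n))
  where
    simplify : ∀ x y → 0ℤ * x + 1ℤ * y ≡ y
    simplify = solve-∀

infixl 6 _⊖_
_⊖_ : Poly → Poly → Poly
p ⊖ q = p ⊕ negP q

pmul-⊖ : ∀ p q F → pmul (p ⊖ q) F ≗ pmul p F ⊟ pmul q F
pmul-⊖ p q F n =
  trans (pmul-⊕ p (negP q) F n)
        (cong (λ t → pmul p F n + t) (trans (pmul-scale -1ℤ q F n) (-1*i≡-i (pmul q F n))))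

_≈ₚ_ : Poly → Poly → Set
p ≈ₚ q = ∀ F → pmul p F ≗ pmul q F

sumS-cong : ∀ N {f g : ℕ → Series} → (∀ j → j < N → f j ≗ g j) → sumS N f ≗ sumS N g
sumS-cong zero    f≗g n = refl
sumS-cong (suc N) f≗g n =
  cong₂ _+_ (sumS-cong N (λ j j<N → f≗g j (ℕ.m≤n⇒m≤1+n j<N)) n) (f≗g N ℕ.≤-refl n)

sumS-⊞ : ∀ N (f g : ℕ → Series) → sumS N (λ j → f j ⊞ g j) ≗ sumS N f ⊞ sumS N g
sumS-⊞ zero    f g n = refl
sumS-⊞ (suc N) f g n =
  trans (cong (λ t → t + (f N n + g N n)) (sumS-⊞ N f g n))
        (interchange (sumS N f n) (sumS N g n) (f N n) (g N n))
  where
    interchange : ∀ a b c d → (a + b) + (c + d) ≡ (a + c) + (b + d)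
    interchange = solve-∀

sumS-⊟ : ∀ N (f g : ℕ → Series) → sumS N (λ j → f j ⊟ g j) ≗ sumS N f ⊟ sumS N g
sumS-⊟ zero    f g n = refl
sumS-⊟ (suc N) f g n =
  trans (cong (λ t → t + (f N n - g N n)) (sumS-⊟ N f g n))
        (interchange (sumS N f n) (sumS N g n) (f N n) (g N n))
  where
    interchange : ∀ a b c d → (a - b) + (c - d) ≡ (a + c) - (b + d)
    interchange = solve-∀

sumS-dropLast : ∀ N (f : ℕ → Series) → f N ≗ 0ˢ → sumS (suc N) f ≗ sumS N f
sumS-dropLast N f fN≗0 n = trans (cong (λ t → sumS N f n + t) (fN≗0 n)) (+-identityʳ (sumS N f n))

sumS-dropFirst : ∀ N (f : ℕ → Series) → f 0 ≗ 0ˢ → sumS (suc N) f ≗ sumS N (λ j → f (suc j))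
sumS-dropFirst zero    f f0≗0 n = trans (+-identityˡ (f 0 n)) (f0≗0 n)
sumS-dropFirst (suc N) f f0≗0 n = cong (_+ f (suc N) n) (sumS-dropFirst N f f0≗0 n)

diffOp : ℕ → (ℕ → Poly) → Op
diffOp N c F = sumS N (λ j → pmul (c j) (Dpow j F))

diffOp-cong : ∀ N c d → (∀ j → j < N → c j ≈ₚ d j) → ∀ F → diffOp N c F ≗ diffOp N d F
diffOp-cong N c d c≈d F = sumS-cong N (λ j j<N → c≈d j j<N (Dpow j F))

diffOp-⊖ : ∀ N c d F → diffOp N c F ⊟ diffOp N d F ≗ diffOp N (λ j → c j ⊖ d j) F
diffOp-⊖ N c d F n = sym (trans
  (sumS-cong N (λ j _ → pmul-⊖ (c j) (d j) (Dpow j F)) n)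
  (sumS-⊟ N (λ j → pmul (c j) (Dpow j F)) (λ j → pmul (d j) (Dpow j F)) n))

shift : (ℕ → Poly) → ℕ → Poly
shift c zero    = []
shift c (suc j) = c j

diffOp-D : ∀ N c F → diffOp N c (D F) ≗ diffOp (suc N) (shift c) F
diffOp-D N c F n = sym (trans
  (sumS-dropFirst N (λ j → pmul (shift c j) (Dpow j F)) (λ _ → refl) n)
  (sumS-cong N (λ j _ → pmul-cong (c j) (λ m → sym (Dpow-D j F m))) n))

coeffs-∘D²z-zD : (ℕ → Poly) → ℕ → Poly
coeffs-∘D²z-zD c j =
  ((Z ⊗ shift (shift c) j) ⊕ ((+ suc j ∷ -1ℤ ∷ []) ⊗ shift c j)) ⊖ scale (+ j) (c j)

pmul-coeffs-∘D²z-zD : ∀ c j F → pmul (coeffs-∘D²z-zD c j) F ≗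
  (zmul (pmul (shift (shift c) j) F) ⊞ ((+ suc j) ⊙ pmul (shift c j) F ⊟ zmul (pmul (shift c j) F)))
  ⊟ (+ j) ⊙ pmul (c j) F
pmul-coeffs-∘D²z-zD c j F n = begin
  pmul (((Z ⊗ c″) ⊕ (L ⊗ c′)) ⊖ scale (+ j) (c j)) F n
    ≡⟨ pmul-⊖ ((Z ⊗ c″) ⊕ (L ⊗ c′)) (scale (+ j) (c j)) F n ⟩
  pmul ((Z ⊗ c″) ⊕ (L ⊗ c′)) F n - pmul (scale (+ j) (c j)) F n
    ≡⟨ cong₂ _-_ (pmul-⊕ (Z ⊗ c″) (L ⊗ c′) F n) (pmul-scale (+ j) (c j) F n) ⟩
  (pmul (Z ⊗ c″) F n + pmul (L ⊗ c′) F n) - + j * pmul (c j) F n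
    ≡⟨ cong₂ (λ x y → (x + y) - + j * pmul (c j) F n)
             (trans (pmul-⊗ Z c″ F n) (pmul-Z (pmul c″ F) n))
             (trans (pmul-⊗ L c′ F n) (pmul-linear (+ suc j) -1ℤ (pmul c′ F) n)) ⟩
  (zmul (pmul c″ F) n + (+ suc j * pmul c′ F n + -1ℤ * zmul (pmul c′ F) n)) - + j * pmul (c j) F n
    ≡⟨ cong (λ t → (zmul (pmul c″ F) n + (+ suc j * pmul c′ F n + t)) - + j * pmul (c j) F n)
            (-1*i≡-i (zmul (pmul c′ F) n)) ⟩
  (zmul (pmul c″ F) n + (+ suc j * pmul c′ F n - zmul (pmul c′ F) n)) - + j * pmul (c j) F n
    ∎
  where
    open ≡-Reasoning
    c′ = shift c j
    c″ = shift (shift c) j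
    L = + suc j ∷ -1ℤ ∷ []

pmul-Dpow-D²z-zD : ∀ p j F → pmul p (Dpow j (D²z-zD F)) ≗
  (zmul (pmul p (Dpow (2 ℕ.+ j) F)) ⊞ ((+ (2 ℕ.+ j)) ⊙ pmul p (Dpow (1 ℕ.+ j) F) ⊟ zmul (pmul p (Dpow (1 ℕ.+ j) F))))
  ⊟ (+ j) ⊙ pmul p (Dpow j F)
pmul-Dpow-D²z-zD p j F n = begin
  pmul p (Dpow j (D²z-zD F)) n
    ≡⟨ pmul-cong p (Dpow-D²z-zD j F) n ⟩
  pmul p ((zmul D₂ ⊞ ((+ (2 ℕ.+ j)) ⊙ D₁ ⊟ zmul D₁)) ⊟ (+ j) ⊙ D₀) n
    ≡⟨ pmul-⊟ p (zmul D₂ ⊞ ((+ (2 ℕ.+ j)) ⊙ D₁ ⊟ zmul D₁)) ((+ j) ⊙ D₀) n ⟩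
  pmul p (zmul D₂ ⊞ ((+ (2 ℕ.+ j)) ⊙ D₁ ⊟ zmul D₁)) n - pmul p ((+ j) ⊙ D₀) n
    ≡⟨ cong₂ _-_ (pmul-⊞ p (zmul D₂) ((+ (2 ℕ.+ j)) ⊙ D₁ ⊟ zmul D₁) n) (pmul-⊙ p (+ j) D₀ n) ⟩
  (pmul p (zmul D₂) n + pmul p ((+ (2 ℕ.+ j)) ⊙ D₁ ⊟ zmul D₁) n) - + j * pmul p D₀ n
    ≡⟨ cong (λ t → (pmul p (zmul D₂) n + t) - + j * pmul p D₀ n) (pmul-⊟ p ((+ (2 ℕ.+ j)) ⊙ D₁) (zmul D₁) n) ⟩
  (pmul p (zmul D₂) n + (pmul p ((+ (2 ℕ.+ j)) ⊙ D₁) n - pmul p (zmul D₁) n)) - + j * pmul p D₀ n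
    ≡⟨ cong₃ (pmul-zmul p D₂ n) (pmul-⊙ p (+ (2 ℕ.+ j)) D₁ n) (pmul-zmul p D₁ n) ⟩
  (zmul (pmul p D₂) n + (+ (2 ℕ.+ j) * pmul p D₁ n - zmul (pmul p D₁) n)) - + j * pmul p D₀ n
    ∎
  where
    open ≡-Reasoning
    D₂ = Dpow (2 ℕ.+ j) F
    D₁ = Dpow (1 ℕ.+ j) F
    D₀ = Dpow j F
    cong₃ : ∀ {x x′ y y′ z z′} → x ≡ x′ → y ≡ y′ → z ≡ z′ →
            (x + (y - z)) - + j * pmul p D₀ n ≡ (x′ + (y′ - z′)) - + j * pmul p D₀ n
    cong₃ refl refl refl = refl

-- On the right, the coefficients at j = N and j = N + 1 still contain −j c_j, so c must vanish there.
diffOp-∘D²z-zD : ∀ N c → (∀ j → N ≤ j → c j ≡ []) → ∀ F →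
  diffOp N c (D²z-zD F) ≗ diffOp (2 ℕ.+ N) (coeffs-∘D²z-zD c) F
diffOp-∘D²z-zD N c c≡[] F n = begin
  diffOp N c (D²z-zD F) n
    ≡⟨ sumS-cong N (λ j _ → pmul-Dpow-D²z-zD (c j) j F) n ⟩
  sumS N (λ j → (zTerm (2 ℕ.+ j) ⊞ dTerm (1 ℕ.+ j)) ⊟ jTerm j) n
    ≡⟨ split N (λ j → zTerm (2 ℕ.+ j)) (λ j → dTerm (1 ℕ.+ j)) jTerm ⟩
  (sumS N (λ j → zTerm (2 ℕ.+ j)) n + sumS N (λ j → dTerm (1 ℕ.+ j)) n) - sumS N jTerm n
    ≡⟨ cong₂ _-_ (cong₂ _+_ (sym zReindex) (sym dReindex)) (sym jReindex) ⟩
  (sumS (2 ℕ.+ N) zTerm n + sumS (2 ℕ.+ N) dTerm n) - sumS (2 ℕ.+ N) jTerm n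
    ≡⟨ split (2 ℕ.+ N) zTerm dTerm jTerm ⟨
  sumS (2 ℕ.+ N) (λ j → (zTerm j ⊞ dTerm j) ⊟ jTerm j) n
    ≡⟨ sumS-cong (2 ℕ.+ N) (λ j _ → pmul-coeffs-∘D²z-zD c j (Dpow j F)) n ⟨
  diffOp (2 ℕ.+ N) (coeffs-∘D²z-zD c) F n
    ∎
  where
    open ≡-Reasoning
    zTerm dTerm jTerm : ℕ → Series
    zTerm j = zmul (pmul (shift (shift c) j) (Dpow j F))
    dTerm j = (+ suc j) ⊙ pmul (shift c j) (Dpow j F) ⊟ zmul (pmul (shift c j) (Dpow j F))
    jTerm j = (+ j) ⊙ pmul (c j) (Dpow j F)

    split : ∀ M (f g h : ℕ → Series) →
            sumS M (λ j → (f j ⊞ g j) ⊟ h j) n ≡ (sumS M f n + sumS M g n) - sumS M h n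
    split M f g h = trans (sumS-⊟ M (λ j → f j ⊞ g j) h n) (cong (_- sumS M h n) (sumS-⊞ M f g n))

    vanishes : ∀ {j} → N ≤ j → ∀ X m → pmul (c j) X m ≡ 0ℤ
    vanishes N≤j X m = cong (λ p → pmul p X m) (c≡[] _ N≤j)

    zReindex : sumS (2 ℕ.+ N) zTerm n ≡ sumS N (λ j → zTerm (2 ℕ.+ j)) n
    zReindex = trans (sumS-dropFirst (suc N) zTerm zmul-0ˢ n)
                     (sumS-dropFirst N (λ j → zTerm (suc j)) zmul-0ˢ n)

    dReindex : sumS (2 ℕ.+ N) dTerm n ≡ sumS N (λ j → dTerm (1 ℕ.+ j)) n
    dReindex = trans (sumS-dropLast (suc N) dTerm dLast n) (sumS-dropFirst N dTerm dFirst n)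
      where
        dFirst : dTerm 0 ≗ 0ˢ
        dFirst m = cong (λ t → + 1 * 0ℤ - t) (zmul-0ˢ m)
        dLast : dTerm (suc N) ≗ 0ˢ
        dLast m = trans (cong₂ (λ x y → + (2 ℕ.+ N) * x - y)
                               (vanishes ℕ.≤-refl (Dpow (suc N) F) m)
                               (trans (zmul-cong (vanishes ℕ.≤-refl (Dpow (suc N) F)) m) (zmul-0ˢ m)))
                        (cong (_- 0ℤ) (*-zeroʳ (+ (2 ℕ.+ N))))

    jReindex : sumS (2 ℕ.+ N) jTerm n ≡ sumS N jTerm n
    jReindex = trans (sumS-dropLast (suc N) jTerm (jLast (ℕ.n≤1+n N)) n)
                     (sumS-dropLast N jTerm (jLast ℕ.≤-refl) n)
      where
        jLast : ∀ {j} → N ≤ j → jTerm j ≗ 0ˢ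
        jLast {j} N≤j m = trans (cong (+ j *_) (vanishes N≤j (Dpow j F) m)) (*-zeroʳ (+ j))

pmul-recurrence : ∀ c′ c j F → pmul (shift c′ j ⊖ coeffs-∘D²z-zD c j) F ≗
  pmul (shift c′ j) F ⊟
    ((zmul (pmul (shift (shift c) j) F) ⊞ ((+ suc j) ⊙ pmul (shift c j) F ⊟ zmul (pmul (shift c j) F)))
     ⊟ (+ j) ⊙ pmul (c j) F)
pmul-recurrence c′ c j F n =
  trans (pmul-⊖ (shift c′ j) (coeffs-∘D²z-zD c j) F n)
        (cong (λ t → pmul (shift c′ j) F n - t) (pmul-coeffs-∘D²z-zD c j F n))

-- m k i multiplies D^(i+1), so mOp k is diffOp (2 + k) (mCoeff k) by definition.
mCoeff : ℕ → ℕ → Poly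
mCoeff k j = m k (+ j - 1ℤ)

<ᵇ-true : ∀ {m n} → m < n → (m ℕ.<ᵇ n) ≡ true
<ᵇ-true m<n = Equivalence.to T-≡ (ℕ.<⇒<ᵇ m<n)

<ᵇ-false : ∀ m n → n ≤ m → (m ℕ.<ᵇ n) ≡ false
<ᵇ-false m       zero    _         = refl
<ᵇ-false (suc m) (suc n) (s≤s n≤m) = <ᵇ-false m n n≤m

m-vanish : ∀ k j → k < j → m k (+ j) ≡ []
m-vanish zero          (suc j)       _ = refl
m-vanish (suc zero)    (suc zero)    (s≤s ())
m-vanish (suc zero)    (suc (suc j)) _ = refl
m-vanish (suc (suc k)) (suc j) (s≤s 2+k≤j)
  rewrite <ᵇ-false j (suc k) (ℕ.≤-trans (ℕ.n≤1+n (suc k)) 2+k≤j)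
        | <ᵇ-false j (suc (suc k)) 2+k≤j
  = refl

mCoeff-vanish : ∀ k j → 2 ℕ.+ k ≤ j → mCoeff k j ≡ []
mCoeff-vanish k (suc j) (s≤s k<j) = m-vanish k j k<j

m-vanish-minusOne : ∀ k → m (suc k) -1ℤ ≡ []
m-vanish-minusOne zero    = refl
m-vanish-minusOne (suc k) = refl

m-zero-periodic : ∀ k → m (3 ℕ.+ k) 0ℤ ≡ m (1 ℕ.+ k) 0ℤ
m-zero-periodic zero    = refl
m-zero-periodic (suc k) = refl

+[1+n]-2≡+n-1 : ∀ n → + suc n - + 2 ≡ + n - 1ℤ
+[1+n]-2≡+n-1 zero    = refl
+[1+n]-2≡+n-1 (suc n) = refl

mCoeff-interior : ∀ k j → j ≤ k → mCoeff (2 ℕ.+ k) (2 ℕ.+ j) ≡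
  ((mCoeff (1 ℕ.+ k) (1 ℕ.+ j) ⊕ scale (+ suc j + 1ℤ) (mCoeff k (2 ℕ.+ j)))
   ⊕ ((- (+ suc j + + 2) ∷ 1ℤ ∷ []) ⊗ mCoeff k (1 ℕ.+ j)))
  ⊕ negP (Z ⊗ mCoeff k j)
mCoeff-interior k j j≤k
  rewrite <ᵇ-true (s≤s j≤k)
        | +[1+n]-2≡+n-1 j
  = refl

m-diagonal-step : ∀ k → m (2 ℕ.+ k) (+ (2 ℕ.+ k)) ≡ m (1 ℕ.+ k) (+ (1 ℕ.+ k)) ⊕ negP (Z ⊗ m k (+ k))
m-diagonal-step k
  rewrite <ᵇ-false (suc k) (suc k) ℕ.≤-refl
        | <ᵇ-true (ℕ.n<1+n (suc k))
  = refl

mCoeff-recurrence-interior : ∀ k j → j ≤ k →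
  mCoeff (2 ℕ.+ k) (2 ℕ.+ j) ≈ₚ (shift (mCoeff (1 ℕ.+ k)) (2 ℕ.+ j) ⊖ coeffs-∘D²z-zD (mCoeff k) (2 ℕ.+ j))
mCoeff-recurrence-interior k j j≤k F n = begin
  pmul (mCoeff (2 ℕ.+ k) (2 ℕ.+ j)) F n
    ≡⟨ cong (λ p → pmul p F n) (mCoeff-interior k j j≤k) ⟩
  pmul (((A ⊕ scale (i + 1ℤ) B) ⊕ (L ⊗ C)) ⊕ negP (Z ⊗ E)) F n
    ≡⟨ pmul-⊕ ((A ⊕ scale (i + 1ℤ) B) ⊕ (L ⊗ C)) (negP (Z ⊗ E)) F n ⟩
  pmul ((A ⊕ scale (i + 1ℤ) B) ⊕ (L ⊗ C)) F n + pmul (negP (Z ⊗ E)) F n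
    ≡⟨ cong₂ _+_ (pmul-⊕ (A ⊕ scale (i + 1ℤ) B) (L ⊗ C) F n)
                 (trans (pmul-scale -1ℤ (Z ⊗ E) F n) (cong (-1ℤ *_) (trans (pmul-⊗ Z E F n) (pmul-Z (pmul E F) n)))) ⟩
  (pmul (A ⊕ scale (i + 1ℤ) B) F n + pmul (L ⊗ C) F n) + -1ℤ * zmul (pmul E F) n
    ≡⟨ cong (λ t → t + -1ℤ * zmul (pmul E F) n)
            (cong₂ _+_ (trans (pmul-⊕ A (scale (i + 1ℤ) B) F n) (cong (λ t → pmul A F n + t) (pmul-scale (i + 1ℤ) B F n)))
                       (trans (pmul-⊗ L C F n) (pmul-linear (- (i + + 2)) 1ℤ (pmul C F) n))) ⟩
  ((pmul A F n + (i + 1ℤ) * pmul B F n) + (- (i + + 2) * pmul C F n + 1ℤ * zmul (pmul C F) n))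
    + -1ℤ * zmul (pmul E F) n
    ≡⟨ rearrange (pmul A F n) (pmul B F n) (pmul C F n) (zmul (pmul C F) n) (zmul (pmul E F) n) i ⟩
  pmul A F n - ((zmul (pmul E F) n + ((+ 2 + i) * pmul C F n - zmul (pmul C F) n)) - (1ℤ + i) * pmul B F n)
    ≡⟨ pmul-recurrence (mCoeff (1 ℕ.+ k)) (mCoeff k) (2 ℕ.+ j) F n ⟨
  pmul (shift (mCoeff (1 ℕ.+ k)) (2 ℕ.+ j) ⊖ coeffs-∘D²z-zD (mCoeff k) (2 ℕ.+ j)) F n
    ∎
  where
    open ≡-Reasoning
    i = + suc j
    A = mCoeff (1 ℕ.+ k) (1 ℕ.+ j)
    B = mCoeff k (2 ℕ.+ j)
    C = mCoeff k (1 ℕ.+ j)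
    E = mCoeff k j
    L = - (i + + 2) ∷ 1ℤ ∷ []
    rearrange : ∀ a b c zc ze i →
      ((a + (i + 1ℤ) * b) + (- (i + + 2) * c + 1ℤ * zc)) + -1ℤ * ze
        ≡ a - ((ze + ((+ 2 + i) * c - zc)) - (1ℤ + i) * b)
    rearrange = solve-∀

mCoeff-recurrence-top : ∀ k →
  mCoeff (2 ℕ.+ k) (3 ℕ.+ k) ≈ₚ (shift (mCoeff (1 ℕ.+ k)) (3 ℕ.+ k) ⊖ coeffs-∘D²z-zD (mCoeff k) (3 ℕ.+ k))
mCoeff-recurrence-top k F n = begin
  pmul (m (2 ℕ.+ k) (+ (2 ℕ.+ k))) F n
    ≡⟨ cong (λ p → pmul p F n) (m-diagonal-step k) ⟩
  pmul (A ⊕ negP (Z ⊗ E)) F n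
    ≡⟨ pmul-⊕ A (negP (Z ⊗ E)) F n ⟩
  pmul A F n + pmul (negP (Z ⊗ E)) F n
    ≡⟨ cong (λ t → pmul A F n + t) (trans (pmul-scale -1ℤ (Z ⊗ E) F n)
                                   (cong (-1ℤ *_) (trans (pmul-⊗ Z E F n) (pmul-Z (pmul E F) n)))) ⟩
  pmul A F n + -1ℤ * zmul (pmul E F) n
    ≡⟨ rearrange (pmul A F n) (zmul (pmul E F) n) (+ (4 ℕ.+ k)) (+ (3 ℕ.+ k)) ⟩
  pmul A F n - ((zmul (pmul E F) n + (+ (4 ℕ.+ k) * 0ℤ - 0ℤ)) - + (3 ℕ.+ k) * 0ℤ)
    ≡⟨ cong₂ (λ x y → pmul A F n - ((zmul (pmul E F) n + (+ (4 ℕ.+ k) * x - y)) - + (3 ℕ.+ k) * 0ℤ))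
             (vanishes ℕ.≤-refl n) (trans (zmul-cong (vanishes ℕ.≤-refl) n) (zmul-0ˢ n)) ⟨
  pmul A F n - ((zmul (pmul E F) n + (+ (4 ℕ.+ k) * pmul B F n - zmul (pmul B F) n)) - + (3 ℕ.+ k) * 0ℤ)
    ≡⟨ cong (λ x → pmul A F n - ((zmul (pmul E F) n + (+ (4 ℕ.+ k) * pmul B F n - zmul (pmul B F) n))
                                  - + (3 ℕ.+ k) * x))
            (vanishes (ℕ.n≤1+n (2 ℕ.+ k)) n) ⟨
  pmul A F n - ((zmul (pmul E F) n + (+ (4 ℕ.+ k) * pmul B F n - zmul (pmul B F) n))
                 - + (3 ℕ.+ k) * pmul (mCoeff k (3 ℕ.+ k)) F n)
    ≡⟨ pmul-recurrence (mCoeff (1 ℕ.+ k)) (mCoeff k) (3 ℕ.+ k) F n ⟨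
  pmul (shift (mCoeff (1 ℕ.+ k)) (3 ℕ.+ k) ⊖ coeffs-∘D²z-zD (mCoeff k) (3 ℕ.+ k)) F n
    ∎
  where
    open ≡-Reasoning
    A = m (1 ℕ.+ k) (+ (1 ℕ.+ k))
    B = mCoeff k (2 ℕ.+ k)
    E = m k (+ k)
    vanishes : ∀ {j} → 2 ℕ.+ k ≤ j → pmul (mCoeff k j) F ≗ 0ˢ
    vanishes 2+k≤j n = cong (λ p → pmul p F n) (mCoeff-vanish k _ 2+k≤j)
    rearrange : ∀ a ze s t → a + -1ℤ * ze ≡ a - ((ze + (s * 0ℤ - 0ℤ)) - t * 0ℤ)
    rearrange = solve-∀

mCoeff-recurrence : ∀ k j → j < 4 ℕ.+ k →
  mCoeff (2 ℕ.+ k) j ≈ₚ (shift (mCoeff (1 ℕ.+ k)) j ⊖ coeffs-∘D²z-zD (mCoeff k) j)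
mCoeff-recurrence k zero _ F n =
  sym (trans (pmul-recurrence (mCoeff (1 ℕ.+ k)) (mCoeff k) 0 F n)
             (cancel (zmul (pmul [] F) n) (pmul (mCoeff k 0) F n)))
  where
    cancel : ∀ z x → 0ℤ - ((z + (+ 1 * 0ℤ - z)) - + 0 * x) ≡ 0ℤ
    cancel = solve-∀
mCoeff-recurrence zero (suc zero) _ F n = refl
mCoeff-recurrence (suc k) (suc zero) _ F n = begin
  pmul (m (3 ℕ.+ k) 0ℤ) F n
    ≡⟨ cong (λ p → pmul p F n) (m-zero-periodic k) ⟩
  pmul (m (1 ℕ.+ k) 0ℤ) F n
    ≡⟨ cancel z (pmul (m (1 ℕ.+ k) 0ℤ) F n) ⟨
  0ℤ - ((z + (+ 2 * pmul [] F n - zmul (pmul [] F) n)) - + 1 * pmul (m (1 ℕ.+ k) 0ℤ) F n)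
    ≡⟨ cong (λ p → 0ℤ - ((z + (+ 2 * pmul p F n - zmul (pmul p F) n)) - + 1 * pmul (m (1 ℕ.+ k) 0ℤ) F n))
            (m-vanish-minusOne k) ⟨
  0ℤ - ((z + (+ 2 * pmul m₋₁ F n - zmul (pmul m₋₁ F) n)) - + 1 * pmul (m (1 ℕ.+ k) 0ℤ) F n)
    ≡⟨ pmul-recurrence (mCoeff (2 ℕ.+ k)) (mCoeff (1 ℕ.+ k)) 1 F n ⟨
  pmul (shift (mCoeff (2 ℕ.+ k)) 1 ⊖ coeffs-∘D²z-zD (mCoeff (1 ℕ.+ k)) 1) F n
    ∎
  where
    open ≡-Reasoning
    z = zmul (pmul [] F) n
    m₋₁ = m (1 ℕ.+ k) -1ℤ
    cancel : ∀ z x → 0ℤ - ((z + (+ 2 * 0ℤ - z)) - + 1 * x) ≡ x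
    cancel = solve-∀
mCoeff-recurrence k (suc (suc j)) (s≤s (s≤s (s≤s j≤1+k))) F n with ℕ.m≤n⇒m<n∨m≡n j≤1+k
... | inj₁ (s≤s j≤k) = mCoeff-recurrence-interior k j j≤k F n
... | inj₂ refl      = mCoeff-recurrence-top k F n

M≗mOp : ∀ k F → M k F ≗ mOp k F
M≗mOp zero F n = begin
  pmul (1ℤ ∷ -1ℤ ∷ []) (D F) n - F n
    ≡⟨ cong (_- F n) (pmul-linear 1ℤ -1ℤ (D F) n) ⟩
  (1ℤ * D F n + -1ℤ * zmul (D F) n) - F n
    ≡⟨ rearrange (D F n) (zmul (D F) n) (F n) ⟩
  0ℤ + -1ℤ * F n + (1ℤ * D F n + -1ℤ * zmul (D F) n)
    ≡⟨ cong₂ (λ x y → 0ℤ + x + y) (pmul-constant -1ℤ F n) (pmul-linear 1ℤ -1ℤ (D F) n) ⟨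
  mOp 0 F n
    ∎
  where
    open ≡-Reasoning
    rearrange : ∀ d zd f → (1ℤ * d + -1ℤ * zd) - f ≡ 0ℤ + -1ℤ * f + (1ℤ * d + -1ℤ * zd)
    rearrange = solve-∀
M≗mOp (suc zero) F n = begin
  pmul (1ℤ ∷ - + 2 ∷ []) (D (D F)) n - pmul (+ 3 ∷ -1ℤ ∷ []) (D F) n
    ≡⟨ cong₂ _-_ (pmul-linear 1ℤ (- + 2) (D (D F)) n) (pmul-linear (+ 3) -1ℤ (D F) n) ⟩
  (1ℤ * D (D F) n + - + 2 * zmul (D (D F)) n) - (+ 3 * D F n + -1ℤ * zmul (D F) n)
    ≡⟨ rearrange (D (D F) n) (zmul (D (D F)) n) (D F n) (zmul (D F) n) ⟩
  0ℤ + 0ℤ + (- + 3 * D F n + 1ℤ * zmul (D F) n) + (1ℤ * D (D F) n + - + 2 * zmul (D (D F)) n)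
    ≡⟨ cong₂ (λ x y → 0ℤ + 0ℤ + x + y) (pmul-linear (- + 3) 1ℤ (D F) n) (pmul-linear 1ℤ (- + 2) (D (D F)) n) ⟨
  mOp 1 F n
    ∎
  where
    open ≡-Reasoning
    rearrange : ∀ dd zdd d zd → (1ℤ * dd + - + 2 * zdd) - (+ 3 * d + -1ℤ * zd)
                  ≡ 0ℤ + 0ℤ + (- + 3 * d + 1ℤ * zd) + (1ℤ * dd + - + 2 * zdd)
    rearrange = solve-∀
M≗mOp (suc (suc k)) F n = begin
  M (1 ℕ.+ k) (D F) n - M k (D²z-zD F) n
    ≡⟨ cong₂ _-_ (M≗mOp (suc k) (D F) n) (M≗mOp k (D²z-zD F) n) ⟩
  diffOp (3 ℕ.+ k) (mCoeff (1 ℕ.+ k)) (D F) n - diffOp (2 ℕ.+ k) (mCoeff k) (D²z-zD F) n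
    ≡⟨ cong₂ _-_ (diffOp-D (3 ℕ.+ k) (mCoeff (1 ℕ.+ k)) F n)
                 (diffOp-∘D²z-zD (2 ℕ.+ k) (mCoeff k) (mCoeff-vanish k) F n) ⟩
  diffOp (4 ℕ.+ k) (shift (mCoeff (1 ℕ.+ k))) F n - diffOp (4 ℕ.+ k) (coeffs-∘D²z-zD (mCoeff k)) F n
    ≡⟨ diffOp-⊖ (4 ℕ.+ k) (shift (mCoeff (1 ℕ.+ k))) (coeffs-∘D²z-zD (mCoeff k)) F n ⟩
  diffOp (4 ℕ.+ k) (λ j → shift (mCoeff (1 ℕ.+ k)) j ⊖ coeffs-∘D²z-zD (mCoeff k) j) F n
    ≡⟨ diffOp-cong (4 ℕ.+ k) (mCoeff (2 ℕ.+ k)) (λ j → shift (mCoeff (1 ℕ.+ k)) j ⊖ coeffs-∘D²z-zD (mCoeff k) j)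
                   (mCoeff-recurrence k) F n ⟨
  mOp (2 ℕ.+ k) F n
    ∎
  where open ≡-Reasoning

m-diagonal : ∀ k → m k (+ k) ≡ ℓ k
m-diagonal zero          = refl
m-diagonal (suc zero)    = refl
m-diagonal (suc (suc k)) =
  trans (m-diagonal-step k) (cong₂ (λ p q → p ⊕ negP (Z ⊗ q)) (m-diagonal (suc k)) (m-diagonal k))

ℓ-head≡1 : ∀ k → ∃ λ t → ℓ k ≡ 1ℤ ∷ t
ℓ-head≡1 zero          = _ , refl
ℓ-head≡1 (suc zero)    = _ , refl
ℓ-head≡1 (suc (suc k)) = step (proj₂ (ℓ-head≡1 (suc k))) (proj₂ (ℓ-head≡1 k))
  where
    step : ∀ {p q t u} → p ≡ 1ℤ ∷ t → q ≡ 1ℤ ∷ u → ∃ λ w → p ⊕ negP (Z ⊗ q) ≡ 1ℤ ∷ w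
    step refl refl = _ , refl

mainTheorem18 : ((k : ℕ) (F : Series) (n : ℕ) → M k F n ≡ mOp k F n)
    × ((k : ℕ) → ∃ λ n → coeff (m k (+ k)) n ≢ 0ℤ)
    × ((k : ℕ) (n : ℕ) → coeff (m k (+ k)) n ≡ coeff (ℓ k) n)
mainTheorem18 = M≗mOp , leading≢0 , λ k n → cong (λ p → coeff p n) (m-diagonal k)
  where
    leading≢0 : (k : ℕ) → ∃ λ n → coeff (m k (+ k)) n ≢ 0ℤ
    leading≢0 k = 0 , λ leading≡0 → 1≢0 (trans (sym leading≡1) leading≡0)
      where
        leading≡1 : coeff (m k (+ k)) 0 ≡ 1ℤ
        leading≡1 = cong (λ p → coeff p 0) (trans (m-diagonal k) (proj₂ (ℓ-head≡1 k)))
        1≢0 : 1ℤ ≢ 0ℤ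
        1≢0 ()
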